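{- Let $(\mu,\eta,\delta,\epsilon)$ be a $\dagger$-SCFA on an object $A$ of a strict symmetric monoidal $\dagger$-category, and let $\alpha:A\to A$ be a phase. Then there exists $\psi:I\to A$ such that (1) $\alpha=\Lambda(\psi)$; (2) $\alpha^{T}=\alpha$; (3) $\alpha^\dagger=\Lambda(\psi^{*})$; (4) $\mu\circ(\psi\otimes\psi^{*})=\eta$.
   Context: A strict symmetric monoidal $\dagger$-category has unit $I$, symmetry $\sigma$, and an involutive identity-on-objects contravariant functor $\dagger$ compatible with $\otimes$; $u$ is unitary if $u^\dagger u=\mathrm{id}$ and $uu^\dagger=\mathrm{id}$. A $\dagger$-SCFA on $A$ is $(\mu,\eta,\delta=\mu^\dagger,\epsilon=\eta^\dagger)$ with $(\mu,\eta)$ a commutative monoid, $(\mu\otimes\mathrm{id})(\mathrm{id}\otimes\delta)=\delta\mu=(\mathrm{id}\otimes\mu)(\delta\otimes\mathrm{id})$, and $\mu\delta=\mathrm{id}_A$. A pre-phase is $\alpha:A\to A$ with $\mu\circ(\alpha\otimes\mathrm{id}_A)=\alpha\circ\mu$; a phase is a unitary pre-phase. For $\psi:I\to A$, $\Lambda(\psi):=\mu\circ(\psi\otimes\mathrm{id}_A)$. With $d:=\delta\eta$, $e:=d^\dagger$: the transpose of $f:A\to A$ is $f^T:=(e\otimes\mathrm{id}_A)(\mathrm{id}_A\otimes f\otimes\mathrm{id}_A)(\mathrm{id}_A\otimes d)$, and the conjugate of a point $\psi:I\to A$ is $\psi^{*}:=(\psi^\dagger\otimes\mathrm{id}_A)\circ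 d$. -}

module Defs where

open import Level using (Level; _⊔_) renaming (suc to lsuc)
open import Relation.Binary.PropositionalEquality using (_≡_; refl; sym; subst)
open import Relation.Binary.Structures using (IsEquivalence)
open import Data.Product using (Σ; _×_)

-- Transport of an identity morphism along an equality of objects.
-- In a strict monoidal category the structural isomorphisms are such casts.
castWith : ∀ {o ℓ} {O : Set o} (H : O → O → Set ℓ) (idm : ∀ {X} → H X X)
           {X Y : O} → X ≡ Y → H X Y
castWith H idm {X} p = subst (H X) p idm

-- Strictness: the associativity and
-- unit laws hold as equalities of objects, and on morphisms the tensor is
-- strictly associative/unital up to the (identity) casts along these equalities.
record StrictSMDaggerCat (o ℓ e : Level) : Set (lsuc (o ⊔ ℓ ⊔ e)) where
  infixr 9 _∘_
  infixr 10 _⊗₀_ _⊗₁_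
  infix 4 _≈_
  infix 15 _†
  field
    Obj : Set o
    Hom : Obj → Obj → Set ℓ
    _≈_ : ∀ {A B} → Hom A B → Hom A B → Set e
    ≈-equiv : ∀ {A B} → IsEquivalence (_≈_ {A} {B})
    id : ∀ {A} → Hom A A
    _∘_ : ∀ {A B C} → Hom B C → Hom A B → Hom A C
    ∘-resp-≈ : ∀ {A B C} {f f' : Hom B C} {g g' : Hom A B} →
               f ≈ f' → g ≈ g' → f ∘ g ≈ f' ∘ g'
    assoc : ∀ {A B C D} {f : Hom C D} {g : Hom B C} {h : Hom A B} →
            (f ∘ g) ∘ h ≈ f ∘ (g ∘ h)
    identityˡ : ∀ {A B} {f : Hom A B} → id ∘ f ≈ f
    identityʳ : ∀ {A B} {f : Hom A B} → f ∘ id ≈ f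
    I : Obj
    _⊗₀_ : Obj → Obj → Obj
    _⊗₁_ : ∀ {A B C D} → Hom A B → Hom C D → Hom (A ⊗₀ C) (B ⊗₀ D)
    ⊗-resp-≈ : ∀ {A B C D} {f f' : Hom A B} {g g' : Hom C D} →
               f ≈ f' → g ≈ g' → f ⊗₁ g ≈ f' ⊗₁ g'
    ⊗-id : ∀ {A B} → id {A} ⊗₁ id {B} ≈ id
    ⊗-∘ : ∀ {A B C D E F} {f : Hom B C} {g : Hom A B} {h : Hom E F} {k : Hom D E} →
          (f ∘ g) ⊗₁ (h ∘ k) ≈ (f ⊗₁ h) ∘ (g ⊗₁ k)
    ⊗-assoc₀ : ∀ {A B C} → (A ⊗₀ B) ⊗₀ C ≡ A ⊗₀ (B ⊗₀ C)
    unitˡ₀ : ∀ {A} → I ⊗₀ A ≡ A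
    unitʳ₀ : ∀ {A} → A ⊗₀ I ≡ A
    cast-irr : ∀ {A B} (p q : A ≡ B) → castWith Hom id p ≈ castWith Hom id q
    ⊗-assoc₁ : ∀ {A A' B B' C C'} {f : Hom A A'} {g : Hom B B'} {h : Hom C C'} →
               (f ⊗₁ g) ⊗₁ h ≈
               castWith Hom id (sym ⊗-assoc₀) ∘ (f ⊗₁ (g ⊗₁ h)) ∘ castWith Hom id ⊗-assoc₀
    unitˡ₁ : ∀ {A B} {f : Hom A B} →
             id {I} ⊗₁ f ≈ castWith Hom id (sym unitˡ₀) ∘ f ∘ castWith Hom id unitˡ₀
    unitʳ₁ : ∀ {A B} {f : Hom A B} →
             f ⊗₁ id {I} ≈ castWith Hom id (sym unitʳ₀) ∘ f ∘ castWith Hom id unitʳ₀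
    σ : ∀ {A B} → Hom (A ⊗₀ B) (B ⊗₀ A)
    σ-natural : ∀ {A B C D} {f : Hom A B} {g : Hom C D} →
                σ ∘ (f ⊗₁ g) ≈ (g ⊗₁ f) ∘ σ
    σ-invol : ∀ {A B} → σ {B} {A} ∘ σ {A} {B} ≈ id
    σ-hexagon : ∀ {A B C} →
                σ {A} {B ⊗₀ C} ≈
                castWith Hom id (sym ⊗-assoc₀) ∘ (id {B} ⊗₁ σ {A} {C}) ∘
                castWith Hom id ⊗-assoc₀ ∘ (σ {A} {B} ⊗₁ id {C}) ∘
                castWith Hom id (sym ⊗-assoc₀)
    _† : ∀ {A B} → Hom A B → Hom B A
    †-resp-≈ : ∀ {A B} {f g : Hom A B} → f ≈ g → f † ≈ g †
    †-id : ∀ {A} → id {A} † ≈ id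
    †-∘ : ∀ {A B C} {f : Hom B C} {g : Hom A B} → (f ∘ g) † ≈ g † ∘ f †
    †-invol : ∀ {A B} {f : Hom A B} → (f †) † ≈ f
    †-⊗ : ∀ {A B C D} {f : Hom A B} {g : Hom C D} → (f ⊗₁ g) † ≈ f † ⊗₁ g †
    σ-† : ∀ {A B} → σ {A} {B} † ≈ σ {B} {A}

  cast : ∀ {A B} → A ≡ B → Hom A B
  cast = castWith Hom id

  unitary : ∀ {A B} → Hom A B → Set e
  unitary u = (u † ∘ u ≈ id) × (u ∘ u † ≈ id)

module _ {o ℓ e} (C : StrictSMDaggerCat o ℓ e) where
  open StrictSMDaggerCat C

  record DaggerSCFA (A : Obj) : Set (ℓ ⊔ e) where
    field
      μ : Hom (A ⊗₀ A) A
      η : Hom I A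
    δ : Hom A (A ⊗₀ A)
    δ = μ †
    ε : Hom A I
    ε = η †
    field
      μ-assoc : μ ∘ (μ ⊗₁ id) ≈ μ ∘ (id ⊗₁ μ) ∘ cast ⊗-assoc₀
      μ-unitˡ : μ ∘ (η ⊗₁ id) ∘ cast (sym unitˡ₀) ≈ id
      μ-unitʳ : μ ∘ (id ⊗₁ η) ∘ cast (sym unitʳ₀) ≈ id
      μ-comm : μ ∘ σ ≈ μ
      frobeniusˡ : (μ ⊗₁ id) ∘ cast (sym ⊗-assoc₀) ∘ (id ⊗₁ δ) ≈ δ ∘ μ
      frobeniusʳ : (id ⊗₁ μ) ∘ cast ⊗-assoc₀ ∘ (δ ⊗₁ id) ≈ δ ∘ μ
      special : μ ∘ δ ≈ id

  module _ {A : Obj} (F : DaggerSCFA A) where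
    open DaggerSCFA F

    IsPrePhase : Hom A A → Set e
    IsPrePhase α = μ ∘ (α ⊗₁ id) ≈ α ∘ μ

    IsPhase : Hom A A → Set e
    IsPhase α = IsPrePhase α × unitary α

    Λ : Hom I A → Hom A A
    Λ ψ = μ ∘ (ψ ⊗₁ id) ∘ cast (sym unitˡ₀)

    d : Hom I (A ⊗₀ A)
    d = δ ∘ η

    e' : Hom (A ⊗₀ A) I
    e' = d †

    transpose : Hom A A → Hom A A
    transpose f = cast unitˡ₀ ∘ (e' ⊗₁ id) ∘ ((id ⊗₁ f) ⊗₁ id) ∘
                  cast (sym ⊗-assoc₀) ∘ (id ⊗₁ d) ∘ cast (sym unitʳ₀)

    conj : Hom I A → Hom I A
    conj ψ = cast unitˡ₀ ∘ (ψ † ⊗₁ id) ∘ d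

module Submission where

-- The point ψ := α ∘ η
-- witnesses all four claims.
--   * Every pre-phase f is multiplication by its value at the unit:
--     f = Λ(f ∘ η), since μ(f ⊗ 1)(η ⊗ 1) = f μ(η ⊗ 1) = f.  This gives (1),
--     and, because the dagger of a phase is again a pre-phase, also
--     α† = Λ(α† ∘ η).
--   * For a pre-phase f the conjugate of the point f ∘ η is f† ∘ η: the
--     dagger of the pre-phase equation lets f† slide through δ, and the
--     remaining (ε ⊗ 1) δ is the identity.  Hence α† = Λ(ψ*), which is (3).
--   * Every pre-phase slides across the cap e = ε μ (by commutativity), and
--     cap and cup satisfy the zigzag equation; so f^T = f, which is (2).
--   * Finally μ(ψ ⊗ ψ*) = Λ(ψ) ψ* = α α† η = η by unitarity, which is (4).

open import Defs
open import Data.Product using (Σ; _×_; _,_)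
open import Relation.Binary.PropositionalEquality using (_≡_; refl; sym)
open import Relation.Binary.Bundles using (Setoid)
import Relation.Binary.Reasoning.Setoid as SetoidReasoning

module PhaseTheory {o ℓ e} (C : StrictSMDaggerCat o ℓ e) where
  open StrictSMDaggerCat C

  homSetoid : Obj → Obj → Setoid ℓ e
  homSetoid X Y = record { Carrier = Hom X Y ; _≈_ = _≈_ ; isEquivalence = ≈-equiv }

  module _ {X Y : Obj} where
    open Setoid (homSetoid X Y) public
      using () renaming (refl to ≈-refl; sym to ≈-sym; trans to ≈-trans)
    open SetoidReasoning (homSetoid X Y) public

  infixr 4 _⟩∘⟨_ refl⟩∘⟨_ _⟩⊗⟨_
  infixl 5 _⟩∘⟨refl

  _⟩∘⟨_ : ∀ {X Y Z} {f f' : Hom Y Z} {g g' : Hom X Y} → f ≈ f' → g ≈ g' → f ∘ g ≈ f' ∘ g'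
  _⟩∘⟨_ = ∘-resp-≈

  refl⟩∘⟨_ : ∀ {X Y Z} {f : Hom Y Z} {g g' : Hom X Y} → g ≈ g' → f ∘ g ≈ f ∘ g'
  refl⟩∘⟨ p = ≈-refl ⟩∘⟨ p

  _⟩∘⟨refl : ∀ {X Y Z} {f f' : Hom Y Z} {g : Hom X Y} → f ≈ f' → f ∘ g ≈ f' ∘ g
  p ⟩∘⟨refl = p ⟩∘⟨ ≈-refl

  _⟩⊗⟨_ : ∀ {X Y Z W} {f f' : Hom X Y} {g g' : Hom Z W} → f ≈ f' → g ≈ g' → f ⊗₁ g ≈ f' ⊗₁ g'
  _⟩⊗⟨_ = ⊗-resp-≈

  pullˡ : ∀ {W X Y Z} {a : Hom Y Z} {b : Hom X Y} {c : Hom X Z} {f : Hom W X} →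
          a ∘ b ≈ c → a ∘ b ∘ f ≈ c ∘ f
  pullˡ p = ≈-trans (≈-sym assoc) (p ⟩∘⟨refl)

  extendʳ : ∀ {W X Y Y' Z} {a : Hom Y Z} {b : Hom X Y} {c : Hom Y' Z} {d : Hom X Y'}
            {f : Hom W X} → a ∘ b ≈ c ∘ d → a ∘ b ∘ f ≈ c ∘ d ∘ f
  extendʳ p = ≈-trans (pullˡ p) assoc

  elimˡ : ∀ {X Y} {a : Hom Y Y} {f : Hom X Y} → a ≈ id → a ∘ f ≈ f
  elimˡ p = ≈-trans (p ⟩∘⟨refl) identityˡ

  elimʳ : ∀ {X Y} {a : Hom X X} {f : Hom X Y} → a ≈ id → f ∘ a ≈ f
  elimʳ p = ≈-trans (refl⟩∘⟨ p) identityʳ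

  cast-cancel : ∀ {X Y} (p : X ≡ Y) → cast p ∘ cast (sym p) ≈ id
  cast-cancel refl = identityˡ

  cast-† : ∀ {X Y} (p : X ≡ Y) → cast (sym p) † ≈ cast p
  cast-† refl = †-id

  -- If f = cast q⁻¹ ∘ g ∘ cast p then f ∘ cast p⁻¹ = cast q⁻¹ ∘ g; this
  -- turns each strictness axiom into a naturality square for the casts.
  cast-natural : ∀ {X Y X' Y'} (p : X ≡ Y) (q : X' ≡ Y') {f : Hom X X'} {g : Hom Y Y'} →
                 f ≈ cast (sym q) ∘ g ∘ cast p → f ∘ cast (sym p) ≈ cast (sym q) ∘ g
  cast-natural p q {f} {g} eq = begin
    f ∘ cast (sym p)                           ≈⟨ eq ⟩∘⟨refl ⟩
    (cast (sym q) ∘ g ∘ cast p) ∘ cast (sym p) ≈⟨ assoc ⟩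
    cast (sym q) ∘ (g ∘ cast p) ∘ cast (sym p) ≈⟨ refl⟩∘⟨ assoc ⟩
    cast (sym q) ∘ g ∘ cast p ∘ cast (sym p)   ≈⟨ refl⟩∘⟨ elimʳ (cast-cancel p) ⟩
    cast (sym q) ∘ g                           ∎

  unitorˡ-natural : ∀ {X Y} {f : Hom X Y} →
                    (id {I} ⊗₁ f) ∘ cast (sym unitˡ₀) ≈ cast (sym unitˡ₀) ∘ f
  unitorˡ-natural = cast-natural unitˡ₀ unitˡ₀ unitˡ₁

  unitorʳ-natural : ∀ {X Y} {f : Hom X Y} →
                    (f ⊗₁ id {I}) ∘ cast (sym unitʳ₀) ≈ cast (sym unitʳ₀) ∘ f
  unitorʳ-natural = cast-natural unitʳ₀ unitʳ₀ unitʳ₁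

  associator-natural : ∀ {X Y B D} {f : Hom X Y} →
                       ((f ⊗₁ id {B}) ⊗₁ id {D}) ∘ cast (sym ⊗-assoc₀) ≈
                       cast (sym ⊗-assoc₀) ∘ (f ⊗₁ id {B ⊗₀ D})
  associator-natural =
    cast-natural ⊗-assoc₀ ⊗-assoc₀ (≈-trans ⊗-assoc₁ (refl⟩∘⟨ (≈-refl ⟩⊗⟨ ⊗-id) ⟩∘⟨refl))

  ⊗id-∘ : ∀ {X Y Z W} {f : Hom Y Z} {g : Hom X Y} → (f ∘ g) ⊗₁ id {W} ≈ (f ⊗₁ id) ∘ (g ⊗₁ id)
  ⊗id-∘ = ≈-trans (≈-refl ⟩⊗⟨ ≈-sym identityˡ) ⊗-∘

  id⊗-∘ : ∀ {X Y Z W} {f : Hom Y Z} {g : Hom X Y} → id {W} ⊗₁ (f ∘ g) ≈ (id ⊗₁ f) ∘ (id ⊗₁ g)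
  id⊗-∘ = ≈-trans (≈-sym identityˡ ⟩⊗⟨ ≈-refl) ⊗-∘

  ⊗-left-first : ∀ {X Y Z W} {f : Hom X Y} {g : Hom Z W} → f ⊗₁ g ≈ (f ⊗₁ id) ∘ (id ⊗₁ g)
  ⊗-left-first = ≈-trans (≈-sym identityʳ ⟩⊗⟨ ≈-sym identityˡ) ⊗-∘

  ⊗-right-first : ∀ {X Y Z W} {f : Hom X Y} {g : Hom Z W} → f ⊗₁ g ≈ (id ⊗₁ g) ∘ (f ⊗₁ id)
  ⊗-right-first = ≈-trans (≈-sym identityˡ ⟩⊗⟨ ≈-sym identityʳ) ⊗-∘

  interchange : ∀ {X Y Z W} {f : Hom X Y} {g : Hom Z W} →
                (f ⊗₁ id) ∘ (id ⊗₁ g) ≈ (id ⊗₁ g) ∘ (f ⊗₁ id)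
  interchange = ≈-trans (≈-sym ⊗-left-first) ⊗-right-first

  module _ {A : Obj} (F : DaggerSCFA C A) where
    open DaggerSCFA F

    -- The counit law for (δ, ε), obtained as the dagger of the unit law.
    counit-law : cast unitˡ₀ ∘ (ε ⊗₁ id) ∘ δ ≈ id
    counit-law = begin
      cast unitˡ₀ ∘ (ε ⊗₁ id) ∘ δ
        ≈⟨ ≈-sym (cast-† unitˡ₀) ⟩∘⟨ ≈-sym (≈-trans †-⊗ (≈-refl ⟩⊗⟨ †-id)) ⟩∘⟨refl ⟩
      cast (sym unitˡ₀) † ∘ (η ⊗₁ id) † ∘ μ †    ≈⟨ refl⟩∘⟨ ≈-sym †-∘ ⟩
      cast (sym unitˡ₀) † ∘ (μ ∘ (η ⊗₁ id)) †    ≈⟨ ≈-sym †-∘ ⟩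
      ((μ ∘ (η ⊗₁ id)) ∘ cast (sym unitˡ₀)) †    ≈⟨ †-resp-≈ (≈-trans assoc μ-unitˡ) ⟩
      id †                                       ≈⟨ †-id ⟩
      id                                         ∎

    cap≈ε∘μ : e' C F ≈ ε ∘ μ
    cap≈ε∘μ = ≈-trans †-∘ (refl⟩∘⟨ †-invol)

    zigzag : cast unitˡ₀ ∘ (e' C F ⊗₁ id) ∘ cast (sym ⊗-assoc₀) ∘ (id ⊗₁ d C F) ∘
             cast (sym unitʳ₀) ≈ id
    zigzag = begin
      cast unitˡ₀ ∘ (e' C F ⊗₁ id) ∘ cast (sym ⊗-assoc₀) ∘ (id ⊗₁ (δ ∘ η)) ∘ cast (sym unitʳ₀)
        ≈⟨ refl⟩∘⟨ ≈-trans (cap≈ε∘μ ⟩⊗⟨ ≈-refl) ⊗id-∘ ⟩∘⟨ (refl⟩∘⟨ id⊗-∘ ⟩∘⟨refl) ⟩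
      cast unitˡ₀ ∘ ((ε ⊗₁ id) ∘ (μ ⊗₁ id)) ∘ cast (sym ⊗-assoc₀) ∘
        ((id ⊗₁ δ) ∘ (id ⊗₁ η)) ∘ cast (sym unitʳ₀)
        ≈⟨ refl⟩∘⟨ ≈-trans assoc (refl⟩∘⟨ refl⟩∘⟨ refl⟩∘⟨ assoc) ⟩
      cast unitˡ₀ ∘ (ε ⊗₁ id) ∘ (μ ⊗₁ id) ∘ cast (sym ⊗-assoc₀) ∘ (id ⊗₁ δ) ∘
        (id ⊗₁ η) ∘ cast (sym unitʳ₀)
        ≈⟨ refl⟩∘⟨ refl⟩∘⟨ refl⟩∘⟨ ≈-sym assoc ⟩
      cast unitˡ₀ ∘ (ε ⊗₁ id) ∘ (μ ⊗₁ id) ∘ (cast (sym ⊗-assoc₀) ∘ (id ⊗₁ δ)) ∘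
        (id ⊗₁ η) ∘ cast (sym unitʳ₀)
        ≈⟨ refl⟩∘⟨ refl⟩∘⟨ pullˡ frobeniusˡ ⟩
      cast unitˡ₀ ∘ (ε ⊗₁ id) ∘ (δ ∘ μ) ∘ (id ⊗₁ η) ∘ cast (sym unitʳ₀)
        ≈⟨ refl⟩∘⟨ refl⟩∘⟨ ≈-trans assoc (elimʳ μ-unitʳ) ⟩
      cast unitˡ₀ ∘ (ε ⊗₁ id) ∘ δ
        ≈⟨ counit-law ⟩
      id ∎

    Λ-resp-≈ : ∀ {ψ φ : Hom I A} → ψ ≈ φ → Λ C F ψ ≈ Λ C F φ
    Λ-resp-≈ p = refl⟩∘⟨ (p ⟩⊗⟨ ≈-refl) ⟩∘⟨refl

    Λ-on-point : (ψ φ : Hom I A) → μ ∘ (ψ ⊗₁ φ) ∘ cast (sym unitˡ₀) ≈ Λ C F ψ ∘ φ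
    Λ-on-point ψ φ = begin
      μ ∘ (ψ ⊗₁ φ) ∘ cast (sym unitˡ₀)                      ≈⟨ refl⟩∘⟨ ⊗-left-first ⟩∘⟨refl ⟩
      μ ∘ ((ψ ⊗₁ id) ∘ (id ⊗₁ φ)) ∘ cast (sym unitˡ₀)       ≈⟨ refl⟩∘⟨ assoc ⟩
      μ ∘ (ψ ⊗₁ id) ∘ (id ⊗₁ φ) ∘ cast (sym unitˡ₀)         ≈⟨ refl⟩∘⟨ refl⟩∘⟨ unitorˡ-natural ⟩
      μ ∘ (ψ ⊗₁ id) ∘ cast (sym unitˡ₀) ∘ φ                 ≈⟨ refl⟩∘⟨ ≈-sym assoc ⟩
      μ ∘ ((ψ ⊗₁ id) ∘ cast (sym unitˡ₀)) ∘ φ               ≈⟨ ≈-sym assoc ⟩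
      Λ C F ψ ∘ φ                                           ∎

    prePhase-Λ : ∀ {f : Hom A A} → IsPrePhase C F f → f ≈ Λ C F (f ∘ η)
    prePhase-Λ {f} pre = ≈-sym (begin
      μ ∘ ((f ∘ η) ⊗₁ id) ∘ cast (sym unitˡ₀)               ≈⟨ refl⟩∘⟨ ⊗id-∘ ⟩∘⟨refl ⟩
      μ ∘ ((f ⊗₁ id) ∘ (η ⊗₁ id)) ∘ cast (sym unitˡ₀)       ≈⟨ refl⟩∘⟨ assoc ⟩
      μ ∘ (f ⊗₁ id) ∘ (η ⊗₁ id) ∘ cast (sym unitˡ₀)         ≈⟨ extendʳ pre ⟩
      f ∘ μ ∘ (η ⊗₁ id) ∘ cast (sym unitˡ₀)                 ≈⟨ elimʳ μ-unitˡ ⟩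
      f                                                     ∎)

    -- By commutativity a pre-phase may equally act on the right factor.
    prePhase-right : ∀ {f : Hom A A} → IsPrePhase C F f → μ ∘ (id ⊗₁ f) ≈ μ ∘ (f ⊗₁ id)
    prePhase-right {f} pre = begin
      μ ∘ (id ⊗₁ f)        ≈⟨ ≈-sym μ-comm ⟩∘⟨refl ⟩
      (μ ∘ σ) ∘ (id ⊗₁ f)  ≈⟨ assoc ⟩
      μ ∘ σ ∘ (id ⊗₁ f)    ≈⟨ refl⟩∘⟨ σ-natural ⟩
      μ ∘ (f ⊗₁ id) ∘ σ    ≈⟨ pullˡ pre ⟩
      (f ∘ μ) ∘ σ          ≈⟨ ≈-trans assoc (refl⟩∘⟨ μ-comm) ⟩
      f ∘ μ                ≈⟨ ≈-sym pre ⟩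
      μ ∘ (f ⊗₁ id)        ∎

    prePhase-cap : ∀ {f : Hom A A} → IsPrePhase C F f →
                   e' C F ∘ (id ⊗₁ f) ≈ e' C F ∘ (f ⊗₁ id)
    prePhase-cap {f} pre = begin
      e' C F ∘ (id ⊗₁ f)   ≈⟨ ≈-trans (cap≈ε∘μ ⟩∘⟨refl) assoc ⟩
      ε ∘ μ ∘ (id ⊗₁ f)    ≈⟨ refl⟩∘⟨ prePhase-right pre ⟩
      ε ∘ μ ∘ (f ⊗₁ id)    ≈⟨ ≈-sym (≈-trans (cap≈ε∘μ ⟩∘⟨refl) assoc) ⟩
      e' C F ∘ (f ⊗₁ id)   ∎

    -- Every pre-phase is its own transpose: slide it off the cap, past the
    -- cup and out of the zigzag.
    prePhase-transpose : ∀ {f : Hom A A} → IsPrePhase C F f → transpose C F f ≈ f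
    prePhase-transpose {f} pre = begin
      cast unitˡ₀ ∘ (e' C F ⊗₁ id) ∘ ((id ⊗₁ f) ⊗₁ id) ∘ cast (sym ⊗-assoc₀) ∘
        (id ⊗₁ d C F) ∘ cast (sym unitʳ₀)
        ≈⟨ refl⟩∘⟨ extendʳ cap-step ⟩
      cast unitˡ₀ ∘ (e' C F ⊗₁ id) ∘ ((f ⊗₁ id) ⊗₁ id) ∘ cast (sym ⊗-assoc₀) ∘
        (id ⊗₁ d C F) ∘ cast (sym unitʳ₀)
        ≈⟨ refl⟩∘⟨ refl⟩∘⟨ extendʳ associator-natural ⟩
      cast unitˡ₀ ∘ (e' C F ⊗₁ id) ∘ cast (sym ⊗-assoc₀) ∘ (f ⊗₁ id) ∘
        (id ⊗₁ d C F) ∘ cast (sym unitʳ₀)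
        ≈⟨ refl⟩∘⟨ refl⟩∘⟨ refl⟩∘⟨ extendʳ interchange ⟩
      cast unitˡ₀ ∘ (e' C F ⊗₁ id) ∘ cast (sym ⊗-assoc₀) ∘ (id ⊗₁ d C F) ∘
        (f ⊗₁ id) ∘ cast (sym unitʳ₀)
        ≈⟨ refl⟩∘⟨ refl⟩∘⟨ refl⟩∘⟨ refl⟩∘⟨ unitorʳ-natural ⟩
      cast unitˡ₀ ∘ (e' C F ⊗₁ id) ∘ cast (sym ⊗-assoc₀) ∘ (id ⊗₁ d C F) ∘
        cast (sym unitʳ₀) ∘ f
        ≈⟨ ≈-sym (≈-trans assoc (refl⟩∘⟨ ≈-trans assoc (refl⟩∘⟨ ≈-trans assoc (refl⟩∘⟨ assoc)))) ⟩
      (cast unitˡ₀ ∘ (e' C F ⊗₁ id) ∘ cast (sym ⊗-assoc₀) ∘ (id ⊗₁ d C F) ∘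
        cast (sym unitʳ₀)) ∘ f
        ≈⟨ elimˡ zigzag ⟩
      f ∎
      where
        cap-step : (e' C F ⊗₁ id) ∘ ((id ⊗₁ f) ⊗₁ id) ≈ (e' C F ⊗₁ id) ∘ ((f ⊗₁ id) ⊗₁ id)
        cap-step = ≈-trans (≈-sym ⊗id-∘) (≈-trans (prePhase-cap pre ⟩⊗⟨ ≈-refl) ⊗id-∘)

    -- The dagger of the pre-phase equation: f† passes through the comultiplication.
    prePhase-comult : ∀ {f : Hom A A} → IsPrePhase C F f → (f † ⊗₁ id) ∘ δ ≈ δ ∘ f †
    prePhase-comult {f} pre = begin
      (f † ⊗₁ id) ∘ δ        ≈⟨ ≈-sym (≈-trans †-⊗ (≈-refl ⟩⊗⟨ †-id)) ⟩∘⟨refl ⟩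
      (f ⊗₁ id) † ∘ μ †      ≈⟨ ≈-sym †-∘ ⟩
      (μ ∘ (f ⊗₁ id)) †      ≈⟨ †-resp-≈ pre ⟩
      (f ∘ μ) †              ≈⟨ †-∘ ⟩
      δ ∘ f †                ∎

    prePhase-conj : ∀ {f : Hom A A} → IsPrePhase C F f → conj C F (f ∘ η) ≈ f † ∘ η
    prePhase-conj {f} pre = begin
      cast unitˡ₀ ∘ ((f ∘ η) † ⊗₁ id) ∘ δ ∘ η
        ≈⟨ refl⟩∘⟨ ≈-trans (†-∘ ⟩⊗⟨ ≈-refl) ⊗id-∘ ⟩∘⟨refl ⟩
      cast unitˡ₀ ∘ ((ε ⊗₁ id) ∘ (f † ⊗₁ id)) ∘ δ ∘ η
        ≈⟨ refl⟩∘⟨ assoc ⟩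
      cast unitˡ₀ ∘ (ε ⊗₁ id) ∘ (f † ⊗₁ id) ∘ δ ∘ η
        ≈⟨ refl⟩∘⟨ refl⟩∘⟨ extendʳ (prePhase-comult pre) ⟩
      cast unitˡ₀ ∘ (ε ⊗₁ id) ∘ δ ∘ f † ∘ η
        ≈⟨ ≈-trans (refl⟩∘⟨ ≈-sym assoc) (≈-sym assoc) ⟩
      (cast unitˡ₀ ∘ (ε ⊗₁ id) ∘ δ) ∘ f † ∘ η
        ≈⟨ elimˡ counit-law ⟩
      f † ∘ η ∎

    -- The dagger of a phase is again a (pre-)phase: it is the inverse.
    phase-† : ∀ {α : Hom A A} → IsPhase C F α → IsPrePhase C F (α †)
    phase-† {α} (pre , α†α≈id , αα†≈id) = begin
      μ ∘ (α † ⊗₁ id)                           ≈⟨ ≈-sym (elimˡ α†α≈id) ⟩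
      (α † ∘ α) ∘ μ ∘ (α † ⊗₁ id)               ≈⟨ ≈-trans assoc (refl⟩∘⟨ pullˡ (≈-sym pre)) ⟩
      α † ∘ (μ ∘ (α ⊗₁ id)) ∘ (α † ⊗₁ id)       ≈⟨ refl⟩∘⟨ assoc ⟩
      α † ∘ μ ∘ (α ⊗₁ id) ∘ (α † ⊗₁ id)         ≈⟨ refl⟩∘⟨ refl⟩∘⟨ ≈-sym ⊗id-∘ ⟩
      α † ∘ μ ∘ ((α ∘ α †) ⊗₁ id)               ≈⟨ refl⟩∘⟨ elimʳ (≈-trans (αα†≈id ⟩⊗⟨ ≈-refl) ⊗-id) ⟩
      α † ∘ μ                                   ∎

lemma2 : ∀ {o ℓ e} (C : StrictSMDaggerCat o ℓ e) →
    let open StrictSMDaggerCat C in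
    ∀ {A : Obj} (F : DaggerSCFA C A) (α : Hom A A) →
    IsPhase C F α →
    Σ (Hom I A) λ ψ →
    (α ≈ Λ C F ψ) ×
    (transpose C F α ≈ α) ×
    (α † ≈ Λ C F (conj C F ψ)) ×
    (DaggerSCFA.μ F ∘ (ψ ⊗₁ conj C F ψ) ∘ cast (sym unitˡ₀) ≈ DaggerSCFA.η F)
lemma2 C F α phase@(pre , _ , αα†≈id) =
    α ∘ η
  , prePhase-Λ F pre
  , prePhase-transpose F pre
  , ≈-trans (prePhase-Λ F (phase-† F phase)) (Λ-resp-≈ F (≈-sym (prePhase-conj F pre)))
  , (begin
      μ ∘ ((α ∘ η) ⊗₁ conj C F (α ∘ η)) ∘ cast (sym unitˡ₀)
        ≈⟨ Λ-on-point F (α ∘ η) (conj C F (α ∘ η)) ⟩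
      Λ C F (α ∘ η) ∘ conj C F (α ∘ η)
        ≈⟨ ≈-sym (prePhase-Λ F pre) ⟩∘⟨ prePhase-conj F pre ⟩
      α ∘ α † ∘ η
        ≈⟨ ≈-trans (≈-sym assoc) (elimˡ αα†≈id) ⟩
      η ∎)
  where
    open PhaseTheory C
    open StrictSMDaggerCat C
    open DaggerSCFA F
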